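{- Let $A$ be a consequence-based algorithm that is correct for a c-property $\mathcal{P}$, and let $\mathcal{O}$ be an ontology in normal form. Let $\mathcal{A}^{pin},\mathcal{B}^{pin}$ be two pinpointing saturated states and $\alpha$ a consequence such that $\alpha:\varphi_\alpha\in\mathcal{A}^{pin}$ and $\alpha:\psi_\alpha\in\mathcal{B}^{pin}$. If $\mathcal{O}^{pin}\rightharpoonup^*\mathcal{A}^{pin}$ and $\mathcal{O}^{pin}\rightharpoonup^*\mathcal{B}^{pin}$, then $\varphi_\alpha\equiv\psi_\alpha$.
   Context: Ontologies and c-properties. An ontology is a finite set of axioms from a fixed class of axioms. A c-property is a relation $\mathcal{P}$ between ontologies and axioms that is monotone: $\mathcal{O}\subseteq\mathcal{O}'$ and $(\mathcal{O},\alpha)\in\mathcal{P}$ imply $(\mathcal{O}',\alpha)\in\mathcal{P}$. Each axiom $\beta$ is labelled with a unique propositional variable $\mathrm{lab}(\beta)$. Monotone Boolean formulae are built from variables and $\top,\bot$ using only $\wedge,\vee$; $\equiv$ denotes logical equivalence. Consequence-based algorithms. The algorithm normalizes the input ontology and then works on states (finite sets of consequences), starting from the normalized ontology. Its rules are pairs $R=\mathcal{B}_0\to\mathcal{B}_1$ of finite sets of consequences. $R$ is applicable to a state $\mathcal{A}$ if $\mathcal{B}_0\subseteq\mathcal{A}$ and $\mathcal{B}_1\not\subseteq\mathcal{A}$, and its application yields $\mathcal{A}\cup\mathcal{B}_1$ (written $\to$; $\to^*$ is the reflexive-transitive closure). A state is saturated if no rule is applicable. For each ontology $\mathcal{O}$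 there is a finite set $\delta(\mathcal{O})$ of derivable consequences. The algorithm is correct for $\mathcal{P}$ if, for every ontology $\mathcal{O}$: (i) a saturated state is reached after finitely many rule applications regardless of the application order; and (ii) if $\mathcal{O}\to^*\mathcal{A}$ with $\mathcal{A}$ saturated, then for every $\beta\in\delta(\mathcal{O})$, $(\mathcal{O},\beta)\in\mathcal{P}$ iff $\beta\in\mathcal{A}$. Pinpointing extension. A pinpointing state $\mathcal{A}^{pin}$ is a set of labelled consequences $\beta:\varphi_\beta$ ($\varphi_\beta$ a monotone Boolean formula, at most one label per consequence), with underlying consequence set $\mathcal{A}$. For a set $X$ of consequences, $\mathrm{fm}(X,\mathcal{A}^{pin}):=\bigwedge_{\beta\in X}\varphi_\beta$, with $\varphi_\beta:=\bot$ if $\beta\notin\mathcal{A}$. A rule $\mathcal{B}_0\to\mathcal{B}_1$ is pinpointing applicable if $\mathrm{fm}(\mathcal{B}_0,\mathcal{A}^{pin})\not\models\mathrm{fm}(\mathcal{B}_1,\mathcal{A}^{pin})$. Its pinpointing application ($\rightharpoonup$, with reflexive-transitive closure $\rightharpoonup^*$) replaces, for each $\beta\in\mathcal{B}_1$, the label $\varphi_\beta$ by $\varphi_\beta\vee\mathrm{fm}(\mathcal{B}_0,\mathcal{A}^{pin})$; absent consequences are added with label $\mathrm{fm}(\mathcal{B}_0,\mathcal{A}^{pin})$. A pinpointing state is pinpointing saturated if no rule is pinpointing applicable. For a normalized ontology $\mathcal{O}$, $\mathcal{O}^{pin}:=\{\beta:\mathrm{lab}(\beta)\mid\beta\in\mathcal{O}\}$.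 -}

module Defs where

open import Data.Bool using (Bool; true; false; if_then_else_)
import Data.Bool as B
open import Data.List using (List; []; _∷_; _++_; map; foldr; [_])
open import Data.Bool.ListAction using (any)
open import Data.List.Membership.Propositional using (_∈_)
open import Data.List.Relation.Binary.Subset.Propositional using (_⊆_)
open import Data.List.Relation.Unary.All using (All)
open import Data.Product using (_×_; _,_; proj₁)
open import Relation.Binary.PropositionalEquality using (_≡_)
open import Relation.Binary.Definitions using (DecidableEquality)
open import Relation.Binary.Construct.Closure.ReflexiveTransitive using (Star)
open import Relation.Nullary using (¬_; does)
open import Induction.WellFounded using (Acc)
open import Function.Bundles using (_⇔_)

data MFm (V : Set) : Set where
  var     : V → MFm V
  ⊤f      : MFm V
  ⊥f      : MFm V
  _∧f_    : MFm V → MFm V → MFm V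
  _∨f_    : MFm V → MFm V → MFm V

⟦_⟧ : {V : Set} → MFm V → (V → Bool) → Bool
⟦ var x ⟧  v = v x
⟦ ⊤f ⟧     v = true
⟦ ⊥f ⟧     v = false
⟦ φ ∧f ψ ⟧ v = ⟦ φ ⟧ v B.∧ ⟦ ψ ⟧ v
⟦ φ ∨f ψ ⟧ v = ⟦ φ ⟧ v B.∨ ⟦ ψ ⟧ v

_⊨_ : {V : Set} → MFm V → MFm V → Set
φ ⊨ ψ = ∀ v → ⟦ φ ⟧ v ≡ true → ⟦ ψ ⟧ v ≡ true

_≣_ : {V : Set} → MFm V → MFm V → Set
φ ≣ ψ = (φ ⊨ ψ) × (ψ ⊨ φ)

-- Ontologies, states: finite sets of axioms/consequences, as lists.
-- The labelling lab(β) is the propositional variable `var β` (unique per axiom).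

record CProperty (Ax : Set) : Set₁ where
  field
    P        : List Ax → Ax → Set
    monotone : ∀ {O O′ α} → O ⊆ O′ → P O α → P O′ α

data Step {Ax : Set} (Rule : List Ax → List Ax → Set) (S : List Ax) : List Ax → Set where
  apply : ∀ {B₀ B₁} → Rule B₀ B₁ → B₀ ⊆ S → ¬ (B₁ ⊆ S) → Step Rule S (S ++ B₁)

record ConsAlg (Ax : Set) : Set₁ where
  field
    Normal     : Ax → Set
    Rule       : List Ax → List Ax → Set
    δ          : List Ax → List Ax
    δ-derivable : ∀ {O S} → All Normal O → Star (Step Rule) O S → S ⊆ δ O

module _ {Ax : Set} (A : ConsAlg Ax) where
  open ConsAlg A

  _⟶_ : List Ax → List Ax → Set
  _⟶_ = Step Rule

  _⟶*_ : List Ax → List Ax → Set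
  _⟶*_ = Star _⟶_

  Saturated : List Ax → Set
  Saturated S = ∀ {S′} → ¬ (S ⟶ S′)

  record Correct (𝒫 : CProperty Ax) : Set where
    field
      terminates : ∀ O → All Normal O → Acc (λ S′ S → S ⟶ S′) O
      sound-complete : ∀ O S → All Normal O → O ⟶* S → Saturated S →
                       ∀ β → β ∈ δ O → (CProperty.P 𝒫 O β ⇔ β ∈ S)

PState : Set → Set
PState Ax = List (Ax × MFm Ax)

module _ {Ax : Set} (_≟_ : DecidableEquality Ax) where

  label : PState Ax → Ax → MFm Ax
  label []            β = ⊥f
  label ((γ , φ) ∷ S) β = if does (β ≟ γ) then φ else label S β

  fm : List Ax → PState Ax → MFm Ax
  fm X S = foldr (λ β ψ → label S β ∧f ψ) ⊤f X

  present : Ax → PState Ax → Bool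
  present β S = any (λ p → does (β ≟ proj₁ p)) S

  addLabel : Ax → MFm Ax → PState Ax → PState Ax
  addLabel β f S =
    if present β S
    then map (λ p → proj₁ p , (if does (β ≟ proj₁ p) then (Data.Product.proj₂ p ∨f f) else Data.Product.proj₂ p)) S
    else S ++ [ (β , f) ]

  applyPin : List Ax → List Ax → PState Ax → PState Ax
  applyPin B₀ B₁ S = foldr (λ β T → addLabel β (fm B₀ S) T) S B₁

  module _ (A : ConsAlg Ax) where
    open ConsAlg A

    data _⇀_ (S : PState Ax) : PState Ax → Set where
      pin : ∀ {B₀ B₁} → Rule B₀ B₁ → ¬ (fm B₀ S ⊨ fm B₁ S) → S ⇀ applyPin B₀ B₁ S

    _⇀*_ : PState Ax → PState Ax → Set
    _⇀*_ = Star _⇀_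

    PinSaturated : PState Ax → Set
    PinSaturated S = ∀ {S′} → ¬ (S ⇀ S′)

_ᵖⁱⁿ : {Ax : Set} → List Ax → PState Ax
O ᵖⁱⁿ = map (λ β → β , var β) O

module Submission where

-- Fix a valuation v of the axiom variables and call γ "true in S" when
-- v satisfies the label of γ in the pinpointing state S.  A pinpointing
-- step for a rule B₀ → B₁ changes the set of true consequences in exactly
-- one way: it adds B₁ when all of B₀ are true, and never removes anything.
-- Hence (1) truth only grows along ⇀*, and (2) truth stays inside every set
-- of consequences that is closed under the rules.  A pinpointing saturated
-- state B is itself rule-closed for v, so every state reachable from O^pin
-- has its true consequences inside those of any saturated state reachable
-- from O^pin (which contains those of O^pin by (1)).  Applied to the
-- reachable saturated states A and B in both directions, the labels of α
-- are true under the same valuations, i.e. they are equivalent.  Since a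
-- state may list a consequence twice, we also show that along ⇀* every
-- listed label is the one returned by the lookup `label`.

open import Defs
open import Data.Bool using (Bool; true; false; if_then_else_; _∨_)
open import Data.Bool.Properties using (∧-conicalˡ; ∧-conicalʳ)
open import Data.Empty using (⊥-elim)
open import Data.List using (List; []; _∷_; _++_; map; foldr; [_])
open import Data.List.Membership.Propositional using (_∈_)
open import Data.List.Membership.Propositional.Properties using (∈-map⁻; ∈-++⁻)
open import Data.List.Relation.Unary.All using (All)
open import Data.List.Relation.Unary.Any using (here; there)
open import Data.Product using (∃; _×_; _,_; proj₁; proj₂)
open import Data.Sum using (_⊎_; inj₁; inj₂)
open import Relation.Binary.Construct.Closure.ReflexiveTransitive using (Star; ε; _◅_)
open import Relation.Binary.Definitions using (DecidableEquality)
open import Relation.Binary.PropositionalEquality using (_≡_; refl; sym; trans; cong; subst)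
open import Relation.Nullary using (yes; no; does; ¬_)

_⊩_ : {V : Set} → (V → Bool) → MFm V → Set
v ⊩ φ = ⟦ φ ⟧ v ≡ true

⊩-≡ : {V : Set} {v : V → Bool} {φ ψ : MFm V} → φ ≡ ψ → v ⊩ φ → v ⊩ ψ
⊩-≡ {v = v} = subst (λ χ → v ⊩ χ)

⊮⊥ : {V : Set} {v : V → Bool} {A : Set} → v ⊩ ⊥f → A
⊮⊥ ()

∨-true-split : ∀ {a b} → a ∨ b ≡ true → a ≡ true ⊎ b ≡ true
∨-true-split {true}  _ = inj₁ refl
∨-true-split {false} p = inj₂ p

∨-true-introˡ : ∀ {a} b → a ≡ true → a ∨ b ≡ true
∨-true-introˡ _ refl = refl

module _ {Ax : Set} (_≟_ : DecidableEquality Ax) where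

  Holds : (Ax → Bool) → PState Ax → Ax → Set
  Holds v S γ = v ⊩ label _≟_ S γ

  -- Every label listed in S is the one found by lookup (S has no
  -- conflicting duplicates); this lets membership facts be read as labels.
  Functional : PState Ax → Set
  Functional S = ∀ {γ χ} → (γ , χ) ∈ S → label _≟_ S γ ≡ χ

  label-absent : ∀ S γ → present _≟_ γ S ≡ false → label _≟_ S γ ≡ ⊥f
  label-absent []            γ _ = refl
  label-absent ((δ , _) ∷ S) γ p with γ ≟ δ
  label-absent ((δ , _) ∷ S) γ () | yes _
  ... | no  _ = label-absent S γ p

  Holds-present : ∀ {v} S γ → Holds v S γ → present _≟_ γ S ≡ true
  Holds-present {v} S γ h with present _≟_ γ S in eq
  ... | true  = refl
  ... | false = ⊮⊥ {v = v} (⊩-≡ (label-absent S γ eq) h)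

  ∈⇒present : ∀ {S γ χ} → (γ , χ) ∈ S → present _≟_ γ S ≡ true
  ∈⇒present {(δ , _) ∷ S} {γ} m with γ ≟ δ
  ... | yes _ = refl
  ∈⇒present (here refl) | no γ≢γ = ⊥-elim (γ≢γ refl)
  ∈⇒present (there m)   | no _   = ∈⇒present m

  label-++ : ∀ S T γ →
             label _≟_ (S ++ T) γ ≡ (if present _≟_ γ S then label _≟_ S γ else label _≟_ T γ)
  label-++ []            T γ = refl
  label-++ ((δ , _) ∷ S) T γ with γ ≟ δ
  ... | yes _ = refl
  ... | no  _ = label-++ S T γ

  -- The map addLabel β f applies when β is already present: it adds the
  -- disjunct f to every entry for β.
  relabel : Ax → MFm Ax → Ax × MFm Ax → Ax × MFm Ax
  relabel β f p = proj₁ p , (if does (β ≟ proj₁ p) then proj₂ p ∨f f else proj₂ p)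

  label-relabel : ∀ β f S γ → present _≟_ γ S ≡ true →
                  label _≟_ (map (relabel β f) S) γ ≡ proj₂ (relabel β f (γ , label _≟_ S γ))
  label-relabel β f ((δ , _) ∷ S) γ p with γ ≟ δ
  ... | yes refl = refl
  ... | no  _    = label-relabel β f S γ p

  Holds-relabel⁺ : ∀ {v} β f S γ → Holds v S γ → Holds v (map (relabel β f) S) γ
  Holds-relabel⁺ β f ((δ , χ) ∷ S) γ h with γ ≟ δ
  ... | no _ = Holds-relabel⁺ β f S γ h
  ... | yes refl with β ≟ γ
  ...   | yes _ = ∨-true-introˡ _ h
  ...   | no  _ = h

  Holds-relabel⁻ : ∀ {v} β f S γ → Holds v (map (relabel β f) S) γ →
                   Holds v S γ ⊎ (γ ≡ β × v ⊩ f)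
  Holds-relabel⁻ β f []            γ ()
  Holds-relabel⁻ β f ((δ , χ) ∷ S) γ h with γ ≟ δ
  ... | no _ = Holds-relabel⁻ β f S γ h
  ... | yes refl with β ≟ γ
  ...   | no  _    = inj₁ h
  ...   | yes refl with ∨-true-split h
  ...     | inj₁ hχ = inj₁ hχ
  ...     | inj₂ hf = inj₂ (refl , hf)

  Holds-addLabel⁺ : ∀ {v} β f S γ → Holds v S γ → Holds v (addLabel _≟_ β f S) γ
  Holds-addLabel⁺ β f S γ h with present _≟_ β S in eq
  ... | true  = Holds-relabel⁺ β f S γ h
  ... | false = ⊩-≡ (sym lookup) h
    where
    lookup : label _≟_ (S ++ [ (β , f) ]) γ ≡ label _≟_ S γ
    lookup rewrite label-++ S [ (β , f) ] γ | Holds-present S γ h = refl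

  Holds-addLabel⁻ : ∀ {v} β f S γ → Holds v (addLabel _≟_ β f S) γ →
                    Holds v S γ ⊎ (γ ≡ β × v ⊩ f)
  Holds-addLabel⁻ {v} β f S γ h with present _≟_ β S in eq
  ... | true  = Holds-relabel⁻ β f S γ h
  ... | false rewrite label-++ S [ (β , f) ] γ with present _≟_ γ S
  ...   | true  = inj₁ h
  ...   | false with γ ≟ β
  ...     | yes γ≡β = inj₂ (γ≡β , h)
  ...     | no  _   = ⊮⊥ {v = v} h

  Functional-addLabel : ∀ β f S → Functional S → Functional (addLabel _≟_ β f S)
  Functional-addLabel β f S fun with present _≟_ β S in eq
  ... | true  = λ m → relabelled (∈-map⁻ (relabel β f) m)
    where
    relabelled : ∀ {γ χ} → ∃ (λ p → p ∈ S × (γ , χ) ≡ relabel β f p) →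
                 label _≟_ (map (relabel β f) S) γ ≡ χ
    relabelled {γ} ((.γ , χ₀) , m₀ , refl) =
      trans (label-relabel β f S γ (∈⇒present m₀))
            (cong (λ χ → proj₂ (relabel β f (γ , χ))) (fun m₀))
  ... | false = λ m → appended (∈-++⁻ S m)
    where
    appended : ∀ {γ χ} → (γ , χ) ∈ S ⊎ (γ , χ) ∈ [ (β , f) ] →
               label _≟_ (S ++ [ (β , f) ]) γ ≡ χ
    appended {γ} (inj₁ m) rewrite label-++ S [ (β , f) ] γ | ∈⇒present m = fun m
    appended (inj₂ (here refl)) rewrite label-++ S [ (β , f) ] β | eq with β ≟ β
    ... | yes _   = refl
    ... | no β≢β = ⊥-elim (β≢β refl)

  -- Adding the same disjunct f to the labels of all of B₁;
  -- `applyPin B₀ B₁ S` is by definition `addLabels (fm B₀ S) B₁ S`.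
  addLabels : MFm Ax → List Ax → PState Ax → PState Ax
  addLabels f B₁ S = foldr (λ β T → addLabel _≟_ β f T) S B₁

  Holds-addLabels⁺ : ∀ {v} f B₁ S γ → Holds v S γ → Holds v (addLabels f B₁ S) γ
  Holds-addLabels⁺ f []       S γ h = h
  Holds-addLabels⁺ f (β ∷ B₁) S γ h =
    Holds-addLabel⁺ β f (addLabels f B₁ S) γ (Holds-addLabels⁺ f B₁ S γ h)

  Holds-addLabels⁻ : ∀ {v} f B₁ S γ → Holds v (addLabels f B₁ S) γ →
                     Holds v S γ ⊎ (γ ∈ B₁ × v ⊩ f)
  Holds-addLabels⁻ f []       S γ h = inj₁ h
  Holds-addLabels⁻ f (β ∷ B₁) S γ h with Holds-addLabel⁻ β f (addLabels f B₁ S) γ h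
  ... | inj₂ (refl , hf) = inj₂ (here refl , hf)
  ... | inj₁ h′ with Holds-addLabels⁻ f B₁ S γ h′
  ...   | inj₁ hS        = inj₁ hS
  ...   | inj₂ (m , hf)  = inj₂ (there m , hf)

  Functional-addLabels : ∀ f B₁ S → Functional S → Functional (addLabels f B₁ S)
  Functional-addLabels f []       S fun = fun
  Functional-addLabels f (β ∷ B₁) S fun =
    Functional-addLabel β f (addLabels f B₁ S) (Functional-addLabels f B₁ S fun)

  fm-elim : ∀ {v} X S {β} → v ⊩ fm _≟_ X S → β ∈ X → Holds v S β
  fm-elim (x ∷ X) S h (here refl) = ∧-conicalˡ _ _ h
  fm-elim (x ∷ X) S h (there m)   = fm-elim X S (∧-conicalʳ _ _ h) m

  fm-intro : ∀ {v} X S → (∀ {β} → β ∈ X → Holds v S β) → v ⊩ fm _≟_ X S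
  fm-intro []      S all = refl
  fm-intro (x ∷ X) S all rewrite all (here refl) = fm-intro X S (λ m → all (there m))

  Functional-init : ∀ O → Functional (O ᵖⁱⁿ)
  Functional-init O m with ∈-map⁻ (λ β → β , var β) m
  ... | (β , mβ , refl) = lookup O mβ
    where
    lookup : ∀ O {β} → β ∈ O → label _≟_ (O ᵖⁱⁿ) β ≡ var β
    lookup (δ ∷ O) {β} m with β ≟ δ
    ... | yes refl = refl
    lookup (δ ∷ O) (here refl) | no β≢β = ⊥-elim (β≢β refl)
    lookup (δ ∷ O) (there m)   | no _   = lookup O m

  module _ (A : ConsAlg Ax) where
    open ConsAlg A using (Rule)

    _⇀ₐ_ : PState Ax → PState Ax → Set
    _⇀ₐ_ = _⇀_ _≟_ A

    Functional-⇀* : ∀ {S T} → Star _⇀ₐ_ S T → Functional S → Functional T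
    Functional-⇀* ε                             fun = fun
    Functional-⇀* {S} (pin {B₀} {B₁} _ _ ◅ steps) fun =
      Functional-⇀* steps (Functional-addLabels (fm _≟_ B₀ S) B₁ S fun)

    Holds-⇀* : ∀ {v S T} → Star _⇀ₐ_ S T → ∀ {γ} → Holds v S γ → Holds v T γ
    Holds-⇀* ε                             h = h
    Holds-⇀* {S = S} (pin {B₀} {B₁} _ _ ◅ steps) {γ} h =
      Holds-⇀* steps (Holds-addLabels⁺ (fm _≟_ B₀ S) B₁ S γ h)

    RuleClosed : (Ax → Set) → Set
    RuleClosed C = ∀ {B₀ B₁} → Rule B₀ B₁ → (∀ {β} → β ∈ B₀ → C β) → ∀ {β} → β ∈ B₁ → C β

    Holds-bounded : ∀ {v C} → RuleClosed C → ∀ {S T} → Star _⇀ₐ_ S T →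
                    (∀ {γ} → Holds v S γ → C γ) → ∀ {γ} → Holds v T γ → C γ
    Holds-bounded closed ε                   bound = bound
    Holds-bounded {v} {C} closed {S} (pin {B₀} {B₁} r _ ◅ steps) bound =
      Holds-bounded closed steps stepped
      where
      stepped : ∀ {γ} → Holds v (applyPin _≟_ B₀ B₁ S) γ → C γ
      stepped {γ} h with Holds-addLabels⁻ (fm _≟_ B₀ S) B₁ S γ h
      ... | inj₁ hS        = bound hS
      ... | inj₂ (m , hf)  = closed r (λ mβ → bound (fm-elim B₀ S hf mβ)) m

    -- A pinpointing saturated state is rule-closed for every valuation:
    -- otherwise the offending rule would be pinpointing applicable.
    saturated-closed : ∀ {v B} → PinSaturated _≟_ A B → RuleClosed (Holds v B)
    saturated-closed {v} {B} sat {B₀} {B₁} r premises {β} m with ⟦ label _≟_ B β ⟧ v in eq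
    ... | true  = refl
    ... | false = ⊥-elim (sat (pin r not-entailed))
      where
      not-entailed : ¬ (fm _≟_ B₀ B ⊨ fm _≟_ B₁ B)
      not-entailed ent with trans (sym (fm-elim B₁ B (ent v (fm-intro B₀ B premises)) m)) eq
      ... | ()

    reachable-below-saturated : ∀ {v O S B} → PinSaturated _≟_ A B →
                                Star _⇀ₐ_ (O ᵖⁱⁿ) S → Star _⇀ₐ_ (O ᵖⁱⁿ) B →
                                ∀ {γ} → Holds v S γ → Holds v B γ
    reachable-below-saturated sat toS toB =
      Holds-bounded (saturated-closed sat) toS (Holds-⇀* toB)

    label-entails : ∀ {O S B α φ ψ} → PinSaturated _≟_ A B →
                    Star _⇀ₐ_ (O ᵖⁱⁿ) S → Star _⇀ₐ_ (O ᵖⁱⁿ) B →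
                    (α , φ) ∈ S → (α , ψ) ∈ B → φ ⊨ ψ
    label-entails {O} sat toS toB mS mB v hφ =
      ⊩-≡ (Functional-⇀* toB (Functional-init O) mB)
        (reachable-below-saturated sat toS toB
          (⊩-≡ (sym (Functional-⇀* toS (Functional-init O) mS)) hφ))

corollary1 : {Ax : Set} (_≟_ : DecidableEquality Ax)
             (𝒫 : CProperty Ax) (A : ConsAlg Ax) → Correct A 𝒫 →
             (O : List Ax) → All (ConsAlg.Normal A) O →
             (Apin Bpin : PState Ax) →
             PinSaturated _≟_ A Apin → PinSaturated _≟_ A Bpin →
             (α : Ax) (φ ψ : MFm Ax) → (α , φ) ∈ Apin → (α , ψ) ∈ Bpin →
             _⇀*_ _≟_ A (O ᵖⁱⁿ) Apin → _⇀*_ _≟_ A (O ᵖⁱⁿ) Bpin →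
             φ ≣ ψ
corollary1 _≟_ _ A _ _ _ _ _ satA satB _ _ _ mA mB toA toB =
  label-entails _≟_ A satB toA toB mA mB ,
  label-entails _≟_ A satA toB toA mB mA
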